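{- Let $\mathcal{C}$ be a category with pullbacks (with a fixed choice of pullback squares) and $T=(T,\eta,\mu)$ a monad on $\mathcal{C}$. For each object $O$, the endofunctor $\overline{T}_O$ on $\mathcal{C}/O$ carries a canonical monad structure, namely the monad $R_OL_O$ induced by the adjunction $L_O\dashv R_O$ described below. Moreover, for each morphism $u\colon O\to O'$, the post-composition functor $\Sigma_u=u\circ(\_)\colon\mathcal{C}/O\to\mathcal{C}/O'$ together with the natural transformation $\theta_u\colon\Sigma_u\overline{T}_O\Rightarrow\overline{T}_{O'}\Sigma_u$ is an (oplax) monad morphism $(\Sigma_u,\theta_u)\colon(\mathcal{C}/O,\overline{T}_O)\to(\mathcal{C}/O',\overline{T}_{O'})$.
   Context: For an object $O$, $\mathcal{C}/O$ is the slice category. For $f\colon X\to O$, the object $\overline{T}_O(f)\colon\overline{T}_OX_f\to O$ of $\mathcal{C}/O$ and the morphism $\iota_f\colon\overline{T}_OX_f\to TX$ are given by the chosen pullback of $\eta_O\colon O\to TO$ along $Tf\colon TX\to TO$ (so $Tf\circ\iota_f=\eta_O\circ\overline{T}_O(f)$); on a morphism $h\colon f\to g$ of $\mathcal{C}/O$, $\overline{T}_O(h)$ is the unique morphism induced by the universality of the pullback of $\eta_O$ along $Tg$. The adjunction: $L_O\colon\mathcal{C}/O\to\mathcal{C}^T/(TO,\mu_O)$ (slice of the Eilenberg–Moore category over the free algebra on $O$) sends $f\colon X\to O$ to $Tf\colon(TX,\mu_X)\to(TO,\mu_O)$; $R_O$ sends an algebra morphism $h\colon(B,b)\to(TO,\mu_O)$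 to the projection onto $O$ of the pullback of $\eta_O$ along $h$. Then $R_OL_O=\overline{T}_O$. For $u\colon O\to O'$ and $f\colon X\to O$, $(\theta_u)_f\colon\overline{T}_OX_f\to\overline{T}_{O'}X_{u\circ f}$ is the morphism induced by the universality of the pullback of $\eta_{O'}$ along $T(u\circ f)$, applied to the pair $(\iota_f,\ u\circ\overline{T}_O(f))$. An (oplax) monad morphism from a monad $(\mathcal{C},S_1)$ to $(\mathcal{D},S_2)$ is a functor $G\colon\mathcal{C}\to\mathcal{D}$ with a natural transformation $\psi\colon GS_1\Rightarrow S_2G$ such that $\psi_X\circ G(\eta^{S_1}_X)=\eta^{S_2}_{GX}$ and $\mu^{S_2}_{GX}\circ S_2\psi_X\circ\psi_{S_1X}=\psi_X\circ G(\mu^{S_1}_X)$ for all $X$. -}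

module Defs where

open import Level using (Level; _⊔_) renaming (suc to lsuc)
open import Relation.Binary using (Rel; IsEquivalence; Setoid)
import Relation.Binary.Reasoning.Setoid as SetoidR

record Category (o ℓ e : Level) : Set (lsuc (o ⊔ ℓ ⊔ e)) where
  infix  4 _≈_
  infixr 9 _∘_
  field
    Obj : Set o
    _⇒_ : Obj → Obj → Set ℓ
    _≈_ : ∀ {A B} → Rel (A ⇒ B) e
    id  : ∀ {A} → A ⇒ A
    _∘_ : ∀ {A B C} → B ⇒ C → A ⇒ B → A ⇒ C
    equiv : ∀ {A B} → IsEquivalence (_≈_ {A} {B})
    ∘-resp-≈ : ∀ {A B C} {f h : B ⇒ C} {g i : A ⇒ B} → f ≈ h → g ≈ i → f ∘ g ≈ h ∘ i
    assoc : ∀ {A B C D} {f : A ⇒ B} {g : B ⇒ C} {h : C ⇒ D} → (h ∘ g) ∘ f ≈ h ∘ (g ∘ f)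
    identityˡ : ∀ {A B} {f : A ⇒ B} → id ∘ f ≈ f
    identityʳ : ∀ {A B} {f : A ⇒ B} → f ∘ id ≈ f

  hom-setoid : ∀ {A B} → Setoid ℓ e
  hom-setoid {A} {B} = record { Carrier = A ⇒ B ; _≈_ = _≈_ ; isEquivalence = equiv }

  module Eq {A B : Obj} = IsEquivalence (equiv {A} {B})

  module HomReasoning {A B : Obj} where
    open SetoidR (hom-setoid {A} {B}) public

record MonadData {o ℓ e} (C : Category o ℓ e) : Set (o ⊔ ℓ) where
  open Category C
  field
    F₀ : Obj → Obj
    F₁ : ∀ {A B} → A ⇒ B → F₀ A ⇒ F₀ B
    η  : ∀ X → X ⇒ F₀ X
    μ  : ∀ X → F₀ (F₀ X) ⇒ F₀ X

record IsMonad {o ℓ e} (C : Category o ℓ e) (M : MonadData C) : Set (o ⊔ ℓ ⊔ e) where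
  open Category C
  open MonadData M
  field
    F-resp-≈ : ∀ {A B} {f g : A ⇒ B} → f ≈ g → F₁ f ≈ F₁ g
    F-identity : ∀ {A} → F₁ (id {A}) ≈ id
    F-homomorphism : ∀ {A B D} {f : A ⇒ B} {g : B ⇒ D} → F₁ (g ∘ f) ≈ F₁ g ∘ F₁ f
    η-natural : ∀ {A B} (f : A ⇒ B) → F₁ f ∘ η A ≈ η B ∘ f
    μ-natural : ∀ {A B} (f : A ⇒ B) → F₁ f ∘ μ A ≈ μ B ∘ F₁ (F₁ f)
    μ-assoc : ∀ X → μ X ∘ F₁ (μ X) ≈ μ X ∘ μ (F₀ X)
    μ-identityˡ : ∀ X → μ X ∘ F₁ (η X) ≈ id
    μ-identityʳ : ∀ X → μ X ∘ η (F₀ X) ≈ id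

record Monad {o ℓ e} (C : Category o ℓ e) : Set (o ⊔ ℓ ⊔ e) where
  field
    monadData : MonadData C
    isMonad   : IsMonad C monadData
  open MonadData monadData public
  open IsMonad isMonad public

record IsOplaxMonadMorphism {o ℓ e o' ℓ' e'}
    (C : Category o ℓ e) (D : Category o' ℓ' e')
    (S₁ : MonadData C) (S₂ : MonadData D)
    (G₀ : Category.Obj C → Category.Obj D)
    (G₁ : ∀ {A B} → Category._⇒_ C A B → Category._⇒_ D (G₀ A) (G₀ B))
    (ψ : ∀ X → Category._⇒_ D (G₀ (MonadData.F₀ S₁ X)) (MonadData.F₀ S₂ (G₀ X)))
    : Set (o ⊔ ℓ ⊔ e ⊔ e') where
  private
    module C = Category C
    module S₁ = MonadData S₁
    module S₂ = MonadData S₂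
  open Category D
  field
    G-resp-≈ : ∀ {A B} {f g : A C.⇒ B} → f C.≈ g → G₁ f ≈ G₁ g
    G-identity : ∀ {A} → G₁ (C.id {A}) ≈ id
    G-homomorphism : ∀ {A B E} {f : A C.⇒ B} {g : B C.⇒ E} → G₁ (g C.∘ f) ≈ G₁ g ∘ G₁ f
    ψ-natural : ∀ {A B} (f : A C.⇒ B) → ψ B ∘ G₁ (S₁.F₁ f) ≈ S₂.F₁ (G₁ f) ∘ ψ A
    ψ-η : ∀ X → ψ X ∘ G₁ (S₁.η X) ≈ S₂.η (G₀ X)
    ψ-μ : ∀ X → S₂.μ (G₀ X) ∘ (S₂.F₁ (ψ X) ∘ ψ (S₁.F₀ X)) ≈ ψ X ∘ G₁ (S₁.μ X)

record Pullback {o ℓ e} (C : Category o ℓ e) {A B X : Category.Obj C}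
    (f : Category._⇒_ C A X) (g : Category._⇒_ C B X) : Set (o ⊔ ℓ ⊔ e) where
  open Category C
  field
    P  : Obj
    p₁ : P ⇒ A
    p₂ : P ⇒ B
    commute : f ∘ p₁ ≈ g ∘ p₂
    universal : ∀ {Q} (h₁ : Q ⇒ A) (h₂ : Q ⇒ B) → f ∘ h₁ ≈ g ∘ h₂ → Q ⇒ P
    p₁∘universal≈h₁ : ∀ {Q} {h₁ : Q ⇒ A} {h₂ : Q ⇒ B} {eq : f ∘ h₁ ≈ g ∘ h₂} →
                      p₁ ∘ universal h₁ h₂ eq ≈ h₁
    p₂∘universal≈h₂ : ∀ {Q} {h₁ : Q ⇒ A} {h₂ : Q ⇒ B} {eq : f ∘ h₁ ≈ g ∘ h₂} →
                      p₂ ∘ universal h₁ h₂ eq ≈ h₂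
    unique : ∀ {Q} {h₁ : Q ⇒ A} {h₂ : Q ⇒ B} {eq : f ∘ h₁ ≈ g ∘ h₂} (i : Q ⇒ P) →
             p₁ ∘ i ≈ h₁ → p₂ ∘ i ≈ h₂ → i ≈ universal h₁ h₂ eq

ChosenPullbacks : ∀ {o ℓ e} → Category o ℓ e → Set (o ⊔ ℓ ⊔ e)
ChosenPullbacks C = ∀ {A B X} (f : Category._⇒_ C A X) (g : Category._⇒_ C B X) → Pullback C f g

module _ {o ℓ e} (C : Category o ℓ e) where
  open Category C

  record SliceObj (O : Obj) : Set (o ⊔ ℓ) where
    constructor sobj
    field
      dom : Obj
      arr : dom ⇒ O

  record SliceHom {O : Obj} (f g : SliceObj O) : Set (ℓ ⊔ e) where
    constructor shom
    field
      h   : SliceObj.dom f ⇒ SliceObj.dom g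
      tri : SliceObj.arr g ∘ h ≈ SliceObj.arr f

  infix 10 _/_
  _/_ : Obj → Category (o ⊔ ℓ) (ℓ ⊔ e) e
  _/_ O = record
    { Obj = SliceObj O
    ; _⇒_ = SliceHom
    ; _≈_ = λ x y → SliceHom.h x ≈ SliceHom.h y
    ; id = shom id identityʳ
    ; _∘_ = λ {a} {b} {c} x y → shom (SliceHom.h x ∘ SliceHom.h y) (comp {a} {b} {c} x y)
    ; equiv = record { refl = Eq.refl ; sym = Eq.sym ; trans = Eq.trans }
    ; ∘-resp-≈ = ∘-resp-≈
    ; assoc = assoc
    ; identityˡ = identityˡ
    ; identityʳ = identityʳ
    }
    where
    comp : ∀ {a b c : SliceObj O} (x : SliceHom b c) (y : SliceHom a b) →
           SliceObj.arr c ∘ (SliceHom.h x ∘ SliceHom.h y) ≈ SliceObj.arr a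
    comp {a} {b} {c} (shom x tx) (shom y ty) = begin
      SliceObj.arr c ∘ (x ∘ y) ≈⟨ Eq.sym assoc ⟩
      (SliceObj.arr c ∘ x) ∘ y ≈⟨ ∘-resp-≈ tx Eq.refl ⟩
      SliceObj.arr b ∘ y       ≈⟨ ty ⟩
      SliceObj.arr a           ∎
      where open HomReasoning

module Construction {o ℓ e} (C : Category o ℓ e) (pb : ChosenPullbacks C) (T : Monad C) where
  open Category C
  open Monad T renaming (F₀ to T₀; F₁ to T₁; η to ηT; μ to μT)
  open HomReasoning
  open SliceObj
  open SliceHom

  private
    _⟩∘⟨_ : ∀ {A B D} {f h : B ⇒ D} {g i : A ⇒ B} → f ≈ h → g ≈ i → f ∘ g ≈ h ∘ i
    _⟩∘⟨_ = ∘-resp-≈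
    infixr 5 _⟩∘⟨_
    rfl : ∀ {A B} {f : A ⇒ B} → f ≈ f
    rfl = Eq.refl

  PB : ∀ {O} (f : SliceObj C O) → Pullback C (T₁ (arr f)) (ηT O)
  PB {O} f = pb (T₁ (arr f)) (ηT O)

  Tbar₀ : ∀ {O} → SliceObj C O → SliceObj C O
  Tbar₀ f = sobj (Pullback.P (PB f)) (Pullback.p₂ (PB f))

  ι : ∀ {O} (f : SliceObj C O) → dom (Tbar₀ f) ⇒ T₀ (dom f)
  ι f = Pullback.p₁ (PB f)

  Tbar₁ : ∀ {O} {f g : SliceObj C O} → SliceHom C f g → SliceHom C (Tbar₀ f) (Tbar₀ g)
  Tbar₁ {O} {f} {g} (shom k t) =
    shom (Pullback.universal (PB g) (T₁ k ∘ ι f) (arr (Tbar₀ f)) sq)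
         (Pullback.p₂∘universal≈h₂ (PB g))
    where
    sq : T₁ (arr g) ∘ (T₁ k ∘ ι f) ≈ ηT O ∘ arr (Tbar₀ f)
    sq = begin
      T₁ (arr g) ∘ (T₁ k ∘ ι f) ≈⟨ Eq.sym assoc ⟩
      (T₁ (arr g) ∘ T₁ k) ∘ ι f ≈⟨ Eq.sym F-homomorphism ⟩∘⟨ rfl ⟩
      T₁ (arr g ∘ k) ∘ ι f      ≈⟨ F-resp-≈ t ⟩∘⟨ rfl ⟩
      T₁ (arr f) ∘ ι f          ≈⟨ Pullback.commute (PB f) ⟩
      ηT O ∘ arr (Tbar₀ f)      ∎

  -- Algebras (B, b) of T together with an algebra morphism B → (T O, μ_O):
  -- the objects of the slice C^T / (T O, μ_O).
  record AlgOver (O : Obj) : Set (o ⊔ ℓ ⊔ e) where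
    field
      car : Obj
      act : T₀ car ⇒ car
      act-assoc : act ∘ T₁ act ≈ act ∘ μT car
      act-unit  : act ∘ ηT car ≈ id
      over : car ⇒ T₀ O
      over-hom : over ∘ act ≈ μT O ∘ T₁ over
  open AlgOver

  record AlgOverHom {O : Obj} (A B : AlgOver O) : Set (ℓ ⊔ e) where
    field
      m : car A ⇒ car B
      m-hom : m ∘ act A ≈ act B ∘ T₁ m
      m-tri : over B ∘ m ≈ over A
  open AlgOverHom

  L₀ : ∀ {O} → SliceObj C O → AlgOver O
  L₀ {O} f = record
    { car = T₀ (dom f) ; act = μT (dom f)
    ; act-assoc = μ-assoc (dom f) ; act-unit = μ-identityʳ (dom f)
    ; over = T₁ (arr f) ; over-hom = μ-natural (arr f) }

  L₁ : ∀ {O} {f g : SliceObj C O} → SliceHom C f g → AlgOverHom (L₀ f) (L₀ g)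
  L₁ {O} {f} {g} (shom k t) = record
    { m = T₁ k ; m-hom = μ-natural k
    ; m-tri = Eq.trans (Eq.sym F-homomorphism) (F-resp-≈ t) }

  PBR : ∀ {O} (A : AlgOver O) → Pullback C (over A) (ηT O)
  PBR {O} A = pb (over A) (ηT O)

  R₀ : ∀ {O} → AlgOver O → SliceObj C O
  R₀ A = sobj (Pullback.P (PBR A)) (Pullback.p₂ (PBR A))

  R₁ : ∀ {O} {A B : AlgOver O} → AlgOverHom A B → SliceHom C (R₀ A) (R₀ B)
  R₁ {O} {A} {B} k = shom
    (Pullback.universal (PBR B) (m k ∘ Pullback.p₁ (PBR A)) (Pullback.p₂ (PBR A)) sq)
    (Pullback.p₂∘universal≈h₂ (PBR B))
    where
    sq : over B ∘ (m k ∘ Pullback.p₁ (PBR A)) ≈ ηT O ∘ Pullback.p₂ (PBR A)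
    sq = begin
      over B ∘ (m k ∘ Pullback.p₁ (PBR A)) ≈⟨ Eq.sym assoc ⟩
      (over B ∘ m k) ∘ Pullback.p₁ (PBR A) ≈⟨ m-tri k ⟩∘⟨ rfl ⟩
      over A ∘ Pullback.p₁ (PBR A)         ≈⟨ Pullback.commute (PBR A) ⟩
      ηT O ∘ Pullback.p₂ (PBR A)           ∎

  unit : ∀ {O} (f : SliceObj C O) → SliceHom C f (R₀ (L₀ f))
  unit f = shom (Pullback.universal (PB f) (ηT (dom f)) (arr f) (η-natural (arr f)))
                (Pullback.p₂∘universal≈h₂ (PB f))

  counit : ∀ {O} (A : AlgOver O) → AlgOverHom (L₀ (R₀ A)) A
  counit {O} A = record { m = act A ∘ T₁ π ; m-hom = hom ; m-tri = tri' }
    where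
    π = Pullback.p₁ (PBR A)
    ρ = Pullback.p₂ (PBR A)
    P' = Pullback.P (PBR A)
    hom : (act A ∘ T₁ π) ∘ μT P' ≈ act A ∘ T₁ (act A ∘ T₁ π)
    hom = begin
      (act A ∘ T₁ π) ∘ μT P'               ≈⟨ assoc ⟩
      act A ∘ (T₁ π ∘ μT P')               ≈⟨ rfl ⟩∘⟨ μ-natural π ⟩
      act A ∘ (μT (car A) ∘ T₁ (T₁ π))     ≈⟨ Eq.sym assoc ⟩
      (act A ∘ μT (car A)) ∘ T₁ (T₁ π)     ≈⟨ Eq.sym (act-assoc A) ⟩∘⟨ rfl ⟩
      (act A ∘ T₁ (act A)) ∘ T₁ (T₁ π)     ≈⟨ assoc ⟩
      act A ∘ (T₁ (act A) ∘ T₁ (T₁ π))     ≈⟨ rfl ⟩∘⟨ Eq.sym F-homomorphism ⟩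
      act A ∘ T₁ (act A ∘ T₁ π)            ∎
    tri' : over A ∘ (act A ∘ T₁ π) ≈ T₁ ρ
    tri' = begin
      over A ∘ (act A ∘ T₁ π)            ≈⟨ Eq.sym assoc ⟩
      (over A ∘ act A) ∘ T₁ π            ≈⟨ over-hom A ⟩∘⟨ rfl ⟩
      (μT O ∘ T₁ (over A)) ∘ T₁ π        ≈⟨ assoc ⟩
      μT O ∘ (T₁ (over A) ∘ T₁ π)        ≈⟨ rfl ⟩∘⟨ Eq.sym F-homomorphism ⟩
      μT O ∘ T₁ (over A ∘ π)             ≈⟨ rfl ⟩∘⟨ F-resp-≈ (Pullback.commute (PBR A)) ⟩
      μT O ∘ T₁ (ηT O ∘ ρ)               ≈⟨ rfl ⟩∘⟨ F-homomorphism ⟩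
      μT O ∘ (T₁ (ηT O) ∘ T₁ ρ)          ≈⟨ Eq.sym assoc ⟩
      (μT O ∘ T₁ (ηT O)) ∘ T₁ ρ          ≈⟨ μ-identityˡ O ⟩∘⟨ rfl ⟩
      id ∘ T₁ ρ                          ≈⟨ identityˡ ⟩
      T₁ ρ                               ∎

  -- The monad R_O L_O = \overline{T}_O induced by the adjunction:
  -- unit = adjunction unit, multiplication = R_O ε L_O.
  ηbar : ∀ {O} (f : SliceObj C O) → SliceHom C f (Tbar₀ f)
  ηbar f = unit f

  μbar : ∀ {O} (f : SliceObj C O) → SliceHom C (Tbar₀ (Tbar₀ f)) (Tbar₀ f)
  μbar f = R₁ (counit (L₀ f))

  TbarData : ∀ O → MonadData (C / O)
  TbarData O = record { F₀ = Tbar₀ ; F₁ = Tbar₁ ; η = ηbar ; μ = μbar }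

  Σ₀ : ∀ {O O'} → O ⇒ O' → SliceObj C O → SliceObj C O'
  Σ₀ u f = sobj (dom f) (u ∘ arr f)

  Σ₁ : ∀ {O O'} (u : O ⇒ O') {f g : SliceObj C O} → SliceHom C f g → SliceHom C (Σ₀ u f) (Σ₀ u g)
  Σ₁ u {f} {g} (shom k t) = shom k (Eq.trans assoc (∘-resp-≈ Eq.refl t))

  θ : ∀ {O O'} (u : O ⇒ O') (f : SliceObj C O) →
      SliceHom C (Σ₀ u (Tbar₀ f)) (Tbar₀ (Σ₀ u f))
  θ {O} {O'} u f = shom
    (Pullback.universal (PB (Σ₀ u f)) (ι f) (u ∘ arr (Tbar₀ f)) sq)
    (Pullback.p₂∘universal≈h₂ (PB (Σ₀ u f)))
    where
    sq : T₁ (u ∘ arr f) ∘ ι f ≈ ηT O' ∘ (u ∘ arr (Tbar₀ f))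
    sq = begin
      T₁ (u ∘ arr f) ∘ ι f             ≈⟨ F-homomorphism ⟩∘⟨ rfl ⟩
      (T₁ u ∘ T₁ (arr f)) ∘ ι f        ≈⟨ assoc ⟩
      T₁ u ∘ (T₁ (arr f) ∘ ι f)        ≈⟨ rfl ⟩∘⟨ Pullback.commute (PB f) ⟩
      T₁ u ∘ (ηT O ∘ arr (Tbar₀ f))    ≈⟨ Eq.sym assoc ⟩
      (T₁ u ∘ ηT O) ∘ arr (Tbar₀ f)    ≈⟨ η-natural u ⟩∘⟨ rfl ⟩
      (ηT O' ∘ u) ∘ arr (Tbar₀ f)      ≈⟨ assoc ⟩
      ηT O' ∘ (u ∘ arr (Tbar₀ f))      ∎

-- A morphism of C/O into \overline{T}_O(f) is determined by its composite with ι_f,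
-- since its other pullback projection must be the structure map to O.  Composing
-- with ι turns the structure of \overline{T}_O into that of T as a Kleisli triple:
-- ι ∘ \overline{T}_O(h) = T h ∘ ι,  ι ∘ \overline{η} = η,
-- ι_f ∘ \overline{μ}_f = ι_f^* ∘ ι_{\overline{T}_O(f)}  (a^* = μ ∘ T a),  ι ∘ θ_u = ι.
-- The monad laws of \overline{T}_O and the oplax laws of (Σ_u, θ_u) thus reduce
-- to the laws of Kleisli extension.
module Submission where

open import Defs
open import Data.Product using (_×_; _,_)

module CategoryReasoning {o ℓ e} (C : Category o ℓ e) where
  open Category C

  infixr 5 _⟩∘⟨_ refl⟩∘⟨_
  infixl 6 _⟩∘⟨refl

  _⟩∘⟨_ : ∀ {A B D} {f g : B ⇒ D} {x y : A ⇒ B} → f ≈ g → x ≈ y → f ∘ x ≈ g ∘ y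
  _⟩∘⟨_ = ∘-resp-≈

  refl⟩∘⟨_ : ∀ {A B D} {f : B ⇒ D} {x y : A ⇒ B} → x ≈ y → f ∘ x ≈ f ∘ y
  refl⟩∘⟨ p = Eq.refl ⟩∘⟨ p

  _⟩∘⟨refl : ∀ {A B D} {f g : B ⇒ D} {x : A ⇒ B} → f ≈ g → f ∘ x ≈ g ∘ x
  p ⟩∘⟨refl = p ⟩∘⟨ Eq.refl

  pullˡ : ∀ {A B D E} {a : D ⇒ E} {b : B ⇒ D} {c : B ⇒ E} {x : A ⇒ B} →
          a ∘ b ≈ c → a ∘ (b ∘ x) ≈ c ∘ x
  pullˡ p = Eq.trans (Eq.sym assoc) (p ⟩∘⟨refl)

  pullʳ : ∀ {A B D E} {a : D ⇒ E} {b : B ⇒ D} {x : A ⇒ B} {c : A ⇒ D} →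
          b ∘ x ≈ c → (a ∘ b) ∘ x ≈ a ∘ c
  pullʳ p = Eq.trans assoc (refl⟩∘⟨ p)

module _ {o ℓ e} {C : Category o ℓ e} where
  open Category C
  open CategoryReasoning C

  Pullback-jointly-monic : ∀ {A B X Q} {f : A ⇒ X} {g : B ⇒ X} (P : Pullback C f g)
    {i j : Q ⇒ Pullback.P P} →
    Pullback.p₁ P ∘ i ≈ Pullback.p₁ P ∘ j → Pullback.p₂ P ∘ i ≈ Pullback.p₂ P ∘ j → i ≈ j
  Pullback-jointly-monic {f = f} {g} P {i} {j} p₁-eq p₂-eq =
    Eq.trans (unique {eq = square} i Eq.refl Eq.refl)
             (Eq.sym (unique {eq = square} j (Eq.sym p₁-eq) (Eq.sym p₂-eq)))
    where
    open Pullback P using (p₁; p₂; commute; unique)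
    square : f ∘ (p₁ ∘ i) ≈ g ∘ (p₂ ∘ i)
    square = Eq.trans (Eq.sym assoc) (Eq.trans (commute ⟩∘⟨refl) assoc)

module Kleisli {o ℓ e} {C : Category o ℓ e} (T : Monad C) where
  open Category C
  open Monad T
  open CategoryReasoning C
  open HomReasoning

  extend : ∀ {A X} → A ⇒ F₀ X → F₀ A ⇒ F₀ X
  extend {X = X} a = μ X ∘ F₁ a

  extend-resp-≈ : ∀ {A X} {a b : A ⇒ F₀ X} → a ≈ b → extend a ≈ extend b
  extend-resp-≈ p = refl⟩∘⟨ F-resp-≈ p

  extend-η : ∀ X → extend (η X) ≈ id
  extend-η = μ-identityˡ

  extend∘η : ∀ {A X} (a : A ⇒ F₀ X) → extend a ∘ η A ≈ a
  extend∘η {A} {X} a = begin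
    (μ X ∘ F₁ a) ∘ η A       ≈⟨ pullʳ (η-natural a) ⟩
    μ X ∘ (η (F₀ X) ∘ a)     ≈⟨ pullˡ (μ-identityʳ X) ⟩
    id ∘ a                   ≈⟨ identityˡ ⟩
    a                        ∎

  extend∘F₁ : ∀ {A B X} (a : B ⇒ F₀ X) (b : A ⇒ B) → extend a ∘ F₁ b ≈ extend (a ∘ b)
  extend∘F₁ a b = pullʳ (Eq.sym F-homomorphism)

  F₁∘extend : ∀ {A X Y} (k : X ⇒ Y) (a : A ⇒ F₀ X) → F₁ k ∘ extend a ≈ extend (F₁ k ∘ a)
  F₁∘extend {Y = Y} k a = begin
    F₁ k ∘ (μ _ ∘ F₁ a)          ≈⟨ pullˡ (μ-natural k) ⟩
    (μ Y ∘ F₁ (F₁ k)) ∘ F₁ a     ≈⟨ extend∘F₁ (F₁ k) a ⟩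
    extend (F₁ k ∘ a)            ∎

  extend-assoc : ∀ {A B X} (a : B ⇒ F₀ X) (b : A ⇒ F₀ B) →
                 extend a ∘ extend b ≈ extend (extend a ∘ b)
  extend-assoc {X = X} a b = begin
    extend a ∘ extend b                        ≈⟨ pullʳ (F₁∘extend a b) ⟩
    μ X ∘ (μ (F₀ X) ∘ F₁ (F₁ a ∘ b))           ≈⟨ pullˡ (Eq.sym (μ-assoc X)) ⟩
    (μ X ∘ F₁ (μ X)) ∘ F₁ (F₁ a ∘ b)           ≈⟨ extend∘F₁ (μ X) (F₁ a ∘ b) ⟩
    extend (μ X ∘ (F₁ a ∘ b))                  ≈⟨ extend-resp-≈ (Eq.sym assoc) ⟩
    extend (extend a ∘ b)                      ∎

module Proof {o ℓ e} (C : Category o ℓ e) (pb : ChosenPullbacks C) (T : Monad C) where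
  open Category C
  open Monad T renaming (F₀ to T₀; F₁ to T₁; η to ηT; μ to μT)
  open Construction C pb T
  open CategoryReasoning C
  open Kleisli T
  open HomReasoning
  open SliceObj
  open SliceHom

  Tbar-hom-ext : ∀ {O} {s f : SliceObj C O} (i j : SliceHom C s (Tbar₀ f)) →
                 ι f ∘ h i ≈ ι f ∘ h j → h i ≈ h j
  Tbar-hom-ext {f = f} i j ι-eq =
    Pullback-jointly-monic (PB f) ι-eq (Eq.trans (tri i) (Eq.sym (tri j)))

  ι∘Tbar₁ : ∀ {O} {f g : SliceObj C O} (k : SliceHom C f g) → ι g ∘ h (Tbar₁ k) ≈ T₁ (h k) ∘ ι f
  ι∘Tbar₁ {g = g} k = Pullback.p₁∘universal≈h₁ (PB g)

  ι∘ηbar : ∀ {O} (f : SliceObj C O) → ι f ∘ h (ηbar f) ≈ ηT (dom f)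
  ι∘ηbar f = Pullback.p₁∘universal≈h₁ (PB f)

  ι∘μbar : ∀ {O} (f : SliceObj C O) → ι f ∘ h (μbar f) ≈ extend (ι f) ∘ ι (Tbar₀ f)
  ι∘μbar f = Pullback.p₁∘universal≈h₁ (PB f)

  ι∘θ : ∀ {O O'} (u : O ⇒ O') (f : SliceObj C O) → ι (Σ₀ u f) ∘ h (θ u f) ≈ ι f
  ι∘θ u f = Pullback.p₁∘universal≈h₁ (PB (Σ₀ u f))

  module _ (O : Obj) where
    private module S = Category (C / O)

    Tbar-resp-≈ : ∀ {f g : SliceObj C O} {k k' : SliceHom C f g} →
                  h k ≈ h k' → h (Tbar₁ k) ≈ h (Tbar₁ k')
    Tbar-resp-≈ {f} {g} {k} {k'} k≈k' = Tbar-hom-ext (Tbar₁ k) (Tbar₁ k') (begin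
      ι g ∘ h (Tbar₁ k)    ≈⟨ ι∘Tbar₁ k ⟩
      T₁ (h k) ∘ ι f       ≈⟨ F-resp-≈ k≈k' ⟩∘⟨refl ⟩
      T₁ (h k') ∘ ι f      ≈⟨ ι∘Tbar₁ k' ⟨
      ι g ∘ h (Tbar₁ k')   ∎)

    Tbar-identity : ∀ {f : SliceObj C O} → h (Tbar₁ (S.id {f})) ≈ id
    Tbar-identity {f} = Tbar-hom-ext (Tbar₁ S.id) S.id (begin
      ι f ∘ h (Tbar₁ S.id) ≈⟨ ι∘Tbar₁ S.id ⟩
      T₁ id ∘ ι f          ≈⟨ F-identity ⟩∘⟨refl ⟩
      id ∘ ι f             ≈⟨ identityˡ ⟩
      ι f                  ≈⟨ identityʳ ⟨
      ι f ∘ id             ∎)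

    Tbar-homomorphism : ∀ {f g d : SliceObj C O} {k : SliceHom C f g} {l : SliceHom C g d} →
                        h (Tbar₁ (l S.∘ k)) ≈ h (Tbar₁ l) ∘ h (Tbar₁ k)
    Tbar-homomorphism {f} {g} {d} {k} {l} =
      Tbar-hom-ext (Tbar₁ (l S.∘ k)) (Tbar₁ l S.∘ Tbar₁ k) (begin
        ι d ∘ h (Tbar₁ (l S.∘ k))           ≈⟨ ι∘Tbar₁ (l S.∘ k) ⟩
        T₁ (h l ∘ h k) ∘ ι f                ≈⟨ F-homomorphism ⟩∘⟨refl ⟩
        (T₁ (h l) ∘ T₁ (h k)) ∘ ι f         ≈⟨ pullʳ (Eq.sym (ι∘Tbar₁ k)) ⟩
        T₁ (h l) ∘ (ι g ∘ h (Tbar₁ k))      ≈⟨ pullˡ (Eq.sym (ι∘Tbar₁ l)) ⟩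
        (ι d ∘ h (Tbar₁ l)) ∘ h (Tbar₁ k)   ≈⟨ assoc ⟩
        ι d ∘ (h (Tbar₁ l) ∘ h (Tbar₁ k))   ∎)

    ηbar-natural : ∀ {f g : SliceObj C O} (k : SliceHom C f g) →
                   h (Tbar₁ k) ∘ h (ηbar f) ≈ h (ηbar g) ∘ h k
    ηbar-natural {f} {g} k = Tbar-hom-ext (Tbar₁ k S.∘ ηbar f) (ηbar g S.∘ k) (begin
      ι g ∘ (h (Tbar₁ k) ∘ h (ηbar f))    ≈⟨ pullˡ (ι∘Tbar₁ k) ⟩
      (T₁ (h k) ∘ ι f) ∘ h (ηbar f)       ≈⟨ pullʳ (ι∘ηbar f) ⟩
      T₁ (h k) ∘ ηT (dom f)               ≈⟨ η-natural (h k) ⟩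
      ηT (dom g) ∘ h k                    ≈⟨ pullˡ (ι∘ηbar g) ⟨
      ι g ∘ (h (ηbar g) ∘ h k)            ∎)

    μbar-natural : ∀ {f g : SliceObj C O} (k : SliceHom C f g) →
                   h (Tbar₁ k) ∘ h (μbar f) ≈ h (μbar g) ∘ h (Tbar₁ (Tbar₁ k))
    μbar-natural {f} {g} k =
      Tbar-hom-ext (Tbar₁ k S.∘ μbar f) (μbar g S.∘ Tbar₁ (Tbar₁ k)) (begin
        ι g ∘ (h (Tbar₁ k) ∘ h (μbar f))                   ≈⟨ pullˡ (ι∘Tbar₁ k) ⟩
        (T₁ (h k) ∘ ι f) ∘ h (μbar f)                      ≈⟨ pullʳ (ι∘μbar f) ⟩
        T₁ (h k) ∘ (extend (ι f) ∘ ι (Tbar₀ f))            ≈⟨ pullˡ (F₁∘extend (h k) (ι f)) ⟩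
        extend (T₁ (h k) ∘ ι f) ∘ ι (Tbar₀ f)              ≈⟨ extend-resp-≈ (ι∘Tbar₁ k) ⟩∘⟨refl ⟨
        extend (ι g ∘ h (Tbar₁ k)) ∘ ι (Tbar₀ f)           ≈⟨ extend∘F₁ (ι g) (h (Tbar₁ k)) ⟩∘⟨refl ⟨
        (extend (ι g) ∘ T₁ (h (Tbar₁ k))) ∘ ι (Tbar₀ f)    ≈⟨ pullʳ (Eq.sym (ι∘Tbar₁ (Tbar₁ k))) ⟩
        extend (ι g) ∘ (ι (Tbar₀ g) ∘ h (Tbar₁ (Tbar₁ k))) ≈⟨ assoc ⟨
        (extend (ι g) ∘ ι (Tbar₀ g)) ∘ h (Tbar₁ (Tbar₁ k)) ≈⟨ pullˡ (ι∘μbar g) ⟨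
        ι g ∘ (h (μbar g) ∘ h (Tbar₁ (Tbar₁ k)))           ∎)

    μbar-assoc : ∀ (f : SliceObj C O) →
                 h (μbar f) ∘ h (Tbar₁ (μbar f)) ≈ h (μbar f) ∘ h (μbar (Tbar₀ f))
    μbar-assoc f =
      Tbar-hom-ext (μbar f S.∘ Tbar₁ (μbar f)) (μbar f S.∘ μbar (Tbar₀ f)) (begin
        ι f ∘ (h (μbar f) ∘ h (Tbar₁ (μbar f)))         ≈⟨ pullˡ (ι∘μbar f) ⟩
        (extend (ι f) ∘ ι f') ∘ h (Tbar₁ (μbar f))      ≈⟨ pullʳ (ι∘Tbar₁ (μbar f)) ⟩
        extend (ι f) ∘ (T₁ (h (μbar f)) ∘ ι f'')        ≈⟨ pullˡ (extend∘F₁ (ι f) (h (μbar f))) ⟩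
        extend (ι f ∘ h (μbar f)) ∘ ι f''               ≈⟨ extend-resp-≈ (ι∘μbar f) ⟩∘⟨refl ⟩
        extend (extend (ι f) ∘ ι f') ∘ ι f''            ≈⟨ pullˡ (extend-assoc (ι f) (ι f')) ⟨
        extend (ι f) ∘ (extend (ι f') ∘ ι f'')          ≈⟨ refl⟩∘⟨ ι∘μbar (Tbar₀ f) ⟨
        extend (ι f) ∘ (ι f' ∘ h (μbar (Tbar₀ f)))      ≈⟨ assoc ⟨
        (extend (ι f) ∘ ι f') ∘ h (μbar (Tbar₀ f))      ≈⟨ pullˡ (ι∘μbar f) ⟨
        ι f ∘ (h (μbar f) ∘ h (μbar (Tbar₀ f)))         ∎)
      where
      f' = Tbar₀ f
      f'' = Tbar₀ f'

    μbar-identityˡ : ∀ (f : SliceObj C O) → h (μbar f) ∘ h (Tbar₁ (ηbar f)) ≈ id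
    μbar-identityˡ f = Tbar-hom-ext (μbar f S.∘ Tbar₁ (ηbar f)) S.id (begin
      ι f ∘ (h (μbar f) ∘ h (Tbar₁ (ηbar f)))          ≈⟨ pullˡ (ι∘μbar f) ⟩
      (extend (ι f) ∘ ι (Tbar₀ f)) ∘ h (Tbar₁ (ηbar f)) ≈⟨ pullʳ (ι∘Tbar₁ (ηbar f)) ⟩
      extend (ι f) ∘ (T₁ (h (ηbar f)) ∘ ι f)           ≈⟨ pullˡ (extend∘F₁ (ι f) (h (ηbar f))) ⟩
      extend (ι f ∘ h (ηbar f)) ∘ ι f                  ≈⟨ extend-resp-≈ (ι∘ηbar f) ⟩∘⟨refl ⟩
      extend (ηT (dom f)) ∘ ι f                        ≈⟨ extend-η (dom f) ⟩∘⟨refl ⟩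
      id ∘ ι f                                         ≈⟨ identityˡ ⟩
      ι f                                              ≈⟨ identityʳ ⟨
      ι f ∘ id                                         ∎)

    μbar-identityʳ : ∀ (f : SliceObj C O) → h (μbar f) ∘ h (ηbar (Tbar₀ f)) ≈ id
    μbar-identityʳ f = Tbar-hom-ext (μbar f S.∘ ηbar (Tbar₀ f)) S.id (begin
      ι f ∘ (h (μbar f) ∘ h (ηbar (Tbar₀ f)))           ≈⟨ pullˡ (ι∘μbar f) ⟩
      (extend (ι f) ∘ ι (Tbar₀ f)) ∘ h (ηbar (Tbar₀ f)) ≈⟨ pullʳ (ι∘ηbar (Tbar₀ f)) ⟩
      extend (ι f) ∘ ηT (dom (Tbar₀ f))                 ≈⟨ extend∘η (ι f) ⟩
      ι f                                               ≈⟨ identityʳ ⟨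
      ι f ∘ id                                          ∎)

    Tbar-isMonad : IsMonad (C / O) (TbarData O)
    Tbar-isMonad = record
      { F-resp-≈ = Tbar-resp-≈ ; F-identity = Tbar-identity ; F-homomorphism = Tbar-homomorphism
      ; η-natural = ηbar-natural ; μ-natural = μbar-natural ; μ-assoc = μbar-assoc
      ; μ-identityˡ = μbar-identityˡ ; μ-identityʳ = μbar-identityʳ }

  module _ {O O' : Obj} (u : O ⇒ O') where
    private module S' = Category (C / O')

    θ-natural : ∀ {f g : SliceObj C O} (k : SliceHom C f g) →
                h (θ u g) ∘ h (Tbar₁ k) ≈ h (Tbar₁ (Σ₁ u k)) ∘ h (θ u f)
    θ-natural {f} {g} k =
      Tbar-hom-ext (θ u g S'.∘ Σ₁ u (Tbar₁ k)) (Tbar₁ (Σ₁ u k) S'.∘ θ u f) (begin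
        ι (Σ₀ u g) ∘ (h (θ u g) ∘ h (Tbar₁ k))           ≈⟨ pullˡ (ι∘θ u g) ⟩
        ι g ∘ h (Tbar₁ k)                                ≈⟨ ι∘Tbar₁ k ⟩
        T₁ (h k) ∘ ι f                                   ≈⟨ pullʳ (ι∘θ u f) ⟨
        (T₁ (h k) ∘ ι (Σ₀ u f)) ∘ h (θ u f)              ≈⟨ pullˡ (ι∘Tbar₁ (Σ₁ u k)) ⟨
        ι (Σ₀ u g) ∘ (h (Tbar₁ (Σ₁ u k)) ∘ h (θ u f))    ∎)

    θ-η : ∀ (f : SliceObj C O) → h (θ u f) ∘ h (ηbar f) ≈ h (ηbar (Σ₀ u f))
    θ-η f = Tbar-hom-ext (θ u f S'.∘ Σ₁ u (ηbar f)) (ηbar (Σ₀ u f)) (begin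
      ι (Σ₀ u f) ∘ (h (θ u f) ∘ h (ηbar f))  ≈⟨ pullˡ (ι∘θ u f) ⟩
      ι f ∘ h (ηbar f)                       ≈⟨ ι∘ηbar f ⟩
      ηT (dom f)                             ≈⟨ ι∘ηbar (Σ₀ u f) ⟨
      ι (Σ₀ u f) ∘ h (ηbar (Σ₀ u f))         ∎)

    θ-μ : ∀ (f : SliceObj C O) →
          h (μbar (Σ₀ u f)) ∘ (h (Tbar₁ (θ u f)) ∘ h (θ u (Tbar₀ f))) ≈ h (θ u f) ∘ h (μbar f)
    θ-μ f = Tbar-hom-ext (μbar uf S'.∘ (Tbar₁ (θ u f) S'.∘ θ u (Tbar₀ f)))
                         (θ u f S'.∘ Σ₁ u (μbar f)) (begin
      ι uf ∘ (h (μbar uf) ∘ (h (Tbar₁ (θ u f)) ∘ h (θ u (Tbar₀ f))))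
        ≈⟨ pullˡ (ι∘μbar uf) ⟩
      (extend (ι uf) ∘ ι (Tbar₀ uf)) ∘ (h (Tbar₁ (θ u f)) ∘ h (θ u (Tbar₀ f)))
        ≈⟨ pullʳ (pullˡ (ι∘Tbar₁ (θ u f))) ⟩
      extend (ι uf) ∘ ((T₁ (h (θ u f)) ∘ ι (Σ₀ u (Tbar₀ f))) ∘ h (θ u (Tbar₀ f)))
        ≈⟨ refl⟩∘⟨ pullʳ (ι∘θ u (Tbar₀ f)) ⟩
      extend (ι uf) ∘ (T₁ (h (θ u f)) ∘ ι (Tbar₀ f))
        ≈⟨ pullˡ (extend∘F₁ (ι uf) (h (θ u f))) ⟩
      extend (ι uf ∘ h (θ u f)) ∘ ι (Tbar₀ f)
        ≈⟨ extend-resp-≈ (ι∘θ u f) ⟩∘⟨refl ⟩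
      extend (ι f) ∘ ι (Tbar₀ f)
        ≈⟨ ι∘μbar f ⟨
      ι f ∘ h (μbar f)
        ≈⟨ pullˡ (ι∘θ u f) ⟨
      ι uf ∘ (h (θ u f) ∘ h (μbar f))
        ∎)
      where
      uf = Σ₀ u f

    Σ-θ-isOplaxMonadMorphism :
      IsOplaxMonadMorphism (C / O) (C / O') (TbarData O) (TbarData O') (Σ₀ u) (Σ₁ u) (θ u)
    Σ-θ-isOplaxMonadMorphism = record
      { G-resp-≈ = λ k≈k' → k≈k' ; G-identity = Eq.refl ; G-homomorphism = Eq.refl
      ; ψ-natural = θ-natural ; ψ-η = θ-η ; ψ-μ = θ-μ }

proposition3p4 : ∀ {o ℓ e} (C : Category o ℓ e) (pb : ChosenPullbacks C) (T : Monad C) →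
    let open Construction C pb T in
    (∀ (O : Category.Obj C) → IsMonad (C / O) (TbarData O))
    × (∀ {O O' : Category.Obj C} (u : Category._⇒_ C O O') →
    IsOplaxMonadMorphism (C / O) (C / O') (TbarData O) (TbarData O') (Σ₀ u) (Σ₁ u) (θ u))
proposition3p4 C pb T = Proof.Tbar-isMonad C pb T , Proof.Σ-θ-isOplaxMonadMorphism C pb T
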